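{- Let $n, k \in \mathbb{N}$ and $x \in V(Q_n)$. Then there is a partition $S(x,k) = B_1 \cup \cdots \cup B_m$ of $S(x,k)$ into $m \leqslant k\binom{n}{k-1} \leqslant 2n^{k-1}$ sets such that for each $j$, any two distinct $y, z \in B_j$ satisfy $d(y,z) \geqslant 2k$.
   Context: $Q_n$ is the hypercube on $\{0,1\}^n$ (vertices adjacent iff they differ in exactly one coordinate), $d$ is graph distance (Hamming distance), and $S(x,k) = \{y \in V(Q_n) : d(x,y) = k\}$. -}

module Defs where

open import Data.Bool using (Bool; true; false)
open import Data.Nat using (ℕ; zero; suc)
open import Data.Vec using (Vec; []; _∷_)
open import Data.Fin using (Fin)
open import Relation.Binary.PropositionalEquality using (_≡_)

Vertex : ℕ → Set
Vertex n = Vec Bool n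

diff : Bool → Bool → ℕ
diff true  true  = 0
diff false false = 0
diff true  false = 1
diff false true  = 1

-- Graph distance in Q_n = Hamming distance
dist : ∀ {n} → Vertex n → Vertex n → ℕ
dist []       []       = 0
dist (a ∷ xs) (b ∷ ys) = diff a b Data.Nat.+ dist xs ys

InSphere : ∀ {n} → Vertex n → ℕ → Vertex n → Set
InSphere x k y = dist x y ≡ k

{-# OPTIONS --safe #-}
module Submission where

-- Write D(v) for the set of coordinates in which v differs from x. For y, z ∈ S(x,k) we have
-- d(y,z) = 2k − 2|D(y) ∩ D(z)|, so d(y,z) < 2k exactly when D(y) and D(z) meet. Such z arise by
-- choosing one of the k coordinates of D(y) and k − 1 further ones, so at most k·C(n,k−1) points
-- of S(x,k), y included, are too close to y, and a greedy colouring of S(x,k) with that many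
-- colours separates every close pair. Finally C(n,j)·j! is the falling factorial n(n−1)⋯(n−j+1),
-- at most n^j, and k ≤ 2·(k−1)!.

open import Defs
open import Data.Nat using (ℕ; _*_; _∸_; _^_; _≤_)
open import Data.Nat.Combinatorics using (_C_)
open import Data.Fin using (Fin)
open import Data.Product using (Σ; _×_)
open import Relation.Binary.PropositionalEquality using (_≡_)
open import Relation.Nullary using (¬_)

open import Data.Bool using (Bool; true; false; T; not; _∧_; if_then_else_)
open import Data.Bool.Properties using (T-∧)
open import Data.Empty using (⊥-elim)
import Data.Fin.Properties as Fin
open import Data.List using (List; []; _∷_; [_]; _++_; map; length; lookup; filter)
open import Data.Vec using ([]; _∷_)
open import Data.List.Membership.Propositional using (_∈_; _∉_)
open import Data.List.Membership.Propositional.Properties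
  using (∈-map⁺; ∈-++⁺ˡ; ∈-++⁺ʳ; ∈-filter⁺; ∈-filter⁻)
open import Data.List.Relation.Unary.Any using (here; there; index; any?)
open import Data.List.Relation.Unary.Any.Properties using (lookup-index)
open import Data.Nat
  using (zero; suc; _+_; _<_; _≡ᵇ_; _<ᵇ_; _≤ᵇ_; _!; _≟_; _≤?_; z≤n; s≤s)
open import Data.Nat.Properties
open import Data.Nat.Combinatorics using (nCk≡nPk/k!; k>n⇒nCk≡0; nCk+nC[k+1]≡[n+1]C[k+1])
open import Data.Nat.Combinatorics.Base using (_P_; _P′_)
open import Data.Nat.DivMod using (_/_; m/n*n≤m)
open import Data.Product using (_,_; proj₁; proj₂; ∃-syntax)
open import Function using (_∘_; Equivalence)
open import Relation.Binary.PropositionalEquality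
  using (refl; sym; trans; cong; cong₂; subst; _≢_)
open import Relation.Nullary using (Dec; yes; no)

private
  variable
    A B : Set
    n : ℕ

nCk≤[1+n]Ck : ∀ n k → n C k ≤ suc n C k
nCk≤[1+n]Ck n zero    = ≤-refl
nCk≤[1+n]Ck n (suc k) =
  ≤-trans (m≤n+m (n C suc k) (n C k)) (≤-reflexive (nCk+nC[k+1]≡[n+1]C[k+1] n k))

nP′k≤n^k : ∀ n k → n P′ k ≤ n ^ k
nP′k≤n^k n zero    = ≤-refl
nP′k≤n^k n (suc k) = *-mono-≤ (m∸n≤m n k) (nP′k≤n^k n k)

nPk≤n^k : ∀ n k → n P k ≤ n ^ k
nPk≤n^k n k with k ≤ᵇ n
... | true  = nP′k≤n^k n k
... | false = z≤n

nCk*k!≤n^k : ∀ n k → (n C k) * k ! ≤ n ^ k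
nCk*k!≤n^k n k with k ≤? n
... | no k≰n rewrite k>n⇒nCk≡0 (≰⇒> k≰n) = z≤n
... | yes k≤n = begin
  (n C k) * k !        ≡⟨ cong (_* k !) (nCk≡nPk/k! k≤n) ⟩
  (n P k) / k ! * k !  ≤⟨ m/n*n≤m (n P k) (k !) ⟩
  n P k                ≤⟨ nPk≤n^k n k ⟩
  n ^ k                ∎
  where
  open ≤-Reasoning
  instance _ = k !≢0

[1+k]≤2*k! : ∀ k → suc k ≤ 2 * k !
[1+k]≤2*k! zero    = s≤s z≤n
[1+k]≤2*k! (suc k) = begin
  2 + k              ≤⟨ +-monoʳ-≤ 2 (m≤n*m k 2) ⟩
  2 + 2 * k          ≡⟨ *-suc 2 k ⟨
  2 * suc k          ≤⟨ *-monoʳ-≤ 2 (m≤m*n (suc k) (k !) {{k !≢0}}) ⟩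
  2 * (suc k * k !)  ∎
  where open ≤-Reasoning

[1+k]*nCk≤2*n^k : ∀ n k → suc k * (n C k) ≤ 2 * n ^ k
[1+k]*nCk≤2*n^k n k = begin
  suc k * (n C k)       ≤⟨ *-monoˡ-≤ (n C k) ([1+k]≤2*k! k) ⟩
  2 * k ! * (n C k)     ≡⟨ *-assoc 2 (k !) (n C k) ⟩
  2 * (k ! * (n C k))   ≡⟨ cong (2 *_) (*-comm (k !) (n C k)) ⟩
  2 * ((n C k) * k !)   ≤⟨ *-monoʳ-≤ 2 (nCk*k!≤n^k n k) ⟩
  2 * n ^ k             ∎
  where open ≤-Reasoning

count : (A → Bool) → List A → ℕ
count p []       = 0
count p (x ∷ xs) = if p x then suc (count p xs) else count p xs

count-mono : {p q : A → Bool} → (∀ x → T (p x) → T (q x)) →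
             ∀ xs → count p xs ≤ count q xs
count-mono p⇒q [] = z≤n
count-mono {p = p} {q} p⇒q (x ∷ xs) with p x | q x | p⇒q x
... | true  | true  | _   = s≤s (count-mono p⇒q xs)
... | true  | false | p⇒q = ⊥-elim (p⇒q _)
... | false | true  | _   = m≤n⇒m≤1+n (count-mono p⇒q xs)
... | false | false | _   = count-mono p⇒q xs

count-none : {p : A → Bool} → (∀ x → ¬ T (p x)) → ∀ xs → count p xs ≡ 0
count-none ¬p [] = refl
count-none {p = p} ¬p (x ∷ xs) with p x | ¬p x
... | true  | ¬px = ⊥-elim (¬px _)
... | false | _   = count-none ¬p xs

count-++ : (p : A → Bool) (xs ys : List A) → count p (xs ++ ys) ≡ count p xs + count p ys
count-++ p []       ys = refl
count-++ p (x ∷ xs) ys with p x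
... | true  = cong suc (count-++ p xs ys)
... | false = count-++ p xs ys

count-map : (p : B → Bool) (f : A → B) (xs : List A) → count p (map f xs) ≡ count (p ∘ f) xs
count-map p f []       = refl
count-map p f (x ∷ xs) with p (f x)
... | true  = cong suc (count-map p f xs)
... | false = count-map p f xs

count-≤-∷ : (p : A → Bool) (x : A) (xs : List A) → count p xs ≤ count p (x ∷ xs)
count-≤-∷ p x xs with p x
... | true  = n≤1+n _
... | false = ≤-refl

count-accept : (p : A → Bool) {x : A} {xs : List A} → T (p x) →
               count p (x ∷ xs) ≡ suc (count p xs)
count-accept p {x} px with p x
... | true = refl

count-filter-≤ : {P : A → Set} (P? : ∀ x → Dec (P x)) {q r : A → Bool} →
                 (∀ {x} → P x → T (q x) → T (r x)) →
                 ∀ xs → count q (filter P? xs) ≤ count r xs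
count-filter-≤ P? pq⇒r [] = z≤n
count-filter-≤ P? {q} {r} pq⇒r (x ∷ xs) with P? x
... | no _ = ≤-trans (count-filter-≤ P? pq⇒r xs) (count-≤-∷ r x xs)
... | yes px with q x | r x | pq⇒r px
...   | true  | true  | _    = s≤s (count-filter-≤ P? pq⇒r xs)
...   | true  | false | q⇒r  = ⊥-elim (q⇒r _)
...   | false | true  | _    = m≤n⇒m≤1+n (count-filter-≤ P? pq⇒r xs)
...   | false | false | _    = count-filter-≤ P? pq⇒r xs

length<⇒∃∉ : ∀ {m} (cs : List (Fin m)) → length cs < m → ∃[ c ] c ∉ cs
length<⇒∃∉ {m} cs |cs|<m =
  Fin.¬∀⟶∃¬ m (_∈ cs) (λ c → any? (c Fin.≟_) cs) λ all∈ →
    <⇒≱ |cs|<m (Fin.injective⇒≤ (position-injective all∈))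
  where
  position-injective : (all∈ : ∀ c → c ∈ cs) →
                       ∀ {c d} → index (all∈ c) ≡ index (all∈ d) → c ≡ d
  position-injective all∈ {c} {d} eq =
    trans (lookup-index (all∈ c)) (trans (cong (lookup cs) eq) (sym (lookup-index (all∈ d))))

module GreedyColouring {A : Set} (_~_ : A → A → Bool)
  (~-refl : ∀ a → T (a ~ a)) (~-sym : ∀ a b → T (a ~ b) → T (b ~ a)) where

  -- Colours are attached to membership proofs, since Fin m may be empty while A is not.
  Colouring : ℕ → List A → Set
  Colouring m xs = ∀ {a} → a ∈ xs → Fin m

  Proper : ∀ {m} xs → Colouring m xs → Set
  Proper xs col = ∀ {a b} (p : a ∈ xs) (q : b ∈ xs) → T (a ~ b) → a ≢ b → col p ≢ col q

  neighbourColours : ∀ {m} (a : A) (xs : List A) → Colouring m xs → List (Fin m)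
  neighbourColours a []       col = []
  neighbourColours a (b ∷ xs) col with a ~ b
  ... | true  = col (here refl) ∷ neighbourColours a xs (col ∘ there)
  ... | false = neighbourColours a xs (col ∘ there)

  length-neighbourColours : ∀ {m} a xs (col : Colouring m xs) →
                            length (neighbourColours a xs col) ≡ count (a ~_) xs
  length-neighbourColours a []       col = refl
  length-neighbourColours a (b ∷ xs) col with a ~ b
  ... | true  = cong suc (length-neighbourColours a xs (col ∘ there))
  ... | false = length-neighbourColours a xs (col ∘ there)

  ∈-neighbourColours : ∀ {m a b} xs (col : Colouring m xs) → T (a ~ b) →
                       (q : b ∈ xs) → col q ∈ neighbourColours a xs col
  ∈-neighbourColours {a = a} (b ∷ xs) col a~b (here refl) with a ~ b
  ... | true = here refl
  ∈-neighbourColours {a = a} (b ∷ xs) col a~b (there q) with a ~ b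
  ... | true  = there (∈-neighbourColours xs (col ∘ there) a~b q)
  ... | false = ∈-neighbourColours xs (col ∘ there) a~b q

  greedy : ∀ m xs → (∀ {a} → a ∈ xs → count (a ~_) xs ≤ m) →
           Σ (Colouring m xs) (Proper xs)
  greedy m []       _   = (λ ()) , λ ()
  greedy m (a ∷ xs) deg = col , proper
    where
    rest : Σ (Colouring m xs) (Proper xs)
    rest = greedy m xs (λ p → ≤-trans (count-≤-∷ _ a xs) (deg (there p)))

    taken : List (Fin m)
    taken = neighbourColours a xs (proj₁ rest)

    |taken|<m : length taken < m
    |taken|<m = begin-strict
      length taken                 ≡⟨ length-neighbourColours a xs (proj₁ rest) ⟩
      count (a ~_) xs              <⟨ n<1+n _ ⟩
      suc (count (a ~_) xs)        ≡⟨ count-accept (a ~_) {xs = xs} (~-refl a) ⟨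
      count (a ~_) (a ∷ xs)        ≤⟨ deg (here refl) ⟩
      m                            ∎
      where open ≤-Reasoning

    fresh : ∃[ c ] c ∉ taken
    fresh = length<⇒∃∉ taken |taken|<m

    col : Colouring m (a ∷ xs)
    col (here refl) = proj₁ fresh
    col (there p)   = proj₁ rest p

    proper : Proper (a ∷ xs) col
    proper (here refl) (here refl) _   a≢a _  = a≢a refl
    proper (here refl) (there q)   a~b _   eq =
      proj₂ fresh (subst (_∈ taken) (sym eq) (∈-neighbourColours xs _ a~b q))
    proper (there p)   (here refl) b~a _   eq =
      proj₂ fresh (subst (_∈ taken) eq (∈-neighbourColours xs _ (~-sym _ _ b~a) p))
    proper (there p)   (there q)   = proj₂ rest p q

vertices : ∀ n → List (Vertex n)
vertices zero    = [ [] ]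
vertices (suc n) = map (true ∷_) (vertices n) ++ map (false ∷_) (vertices n)

∈-vertices : (v : Vertex n) → v ∈ vertices n
∈-vertices []          = here refl
∈-vertices (true  ∷ v) = ∈-++⁺ˡ (∈-map⁺ (true ∷_) (∈-vertices v))
∈-vertices (false ∷ v) =
  ∈-++⁺ʳ (map (true ∷_) (vertices _)) (∈-map⁺ (false ∷_) (∈-vertices v))

count-vertices-suc : ∀ a (p : Vertex (suc n) → Bool) →
  count p (vertices (suc n))
    ≡ count (p ∘ (a ∷_)) (vertices n) + count (p ∘ (not a ∷_)) (vertices n)
count-vertices-suc {n} true p =
  trans (count-++ p (map (true ∷_) (vertices n)) _)
        (cong₂ _+_ (count-map p (true ∷_) (vertices n)) (count-map p (false ∷_) (vertices n)))
count-vertices-suc {n} false p =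
  trans (count-vertices-suc true p) (+-comm (count (p ∘ (true ∷_)) (vertices n)) _)

diff-sym : ∀ a b → diff a b ≡ diff b a
diff-sym true  true  = refl
diff-sym true  false = refl
diff-sym false true  = refl
diff-sym false false = refl

dist-sym : (x y : Vertex n) → dist x y ≡ dist y x
dist-sym []      []      = refl
dist-sym (a ∷ x) (b ∷ y) = cong₂ _+_ (diff-sym a b) (dist-sym x y)

dist-self : (x : Vertex n) → dist x x ≡ 0
dist-self []          = refl
dist-self (true  ∷ x) = dist-self x
dist-self (false ∷ x) = dist-self x

dist≡0⇒≡ : (x y : Vertex n) → dist x y ≡ 0 → x ≡ y
dist≡0⇒≡ []          []          _  = refl
dist≡0⇒≡ (true  ∷ x) (true  ∷ y) eq = cong (true ∷_) (dist≡0⇒≡ x y eq)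
dist≡0⇒≡ (false ∷ x) (false ∷ y) eq = cong (false ∷_) (dist≡0⇒≡ x y eq)

sphereᵇ : Vertex n → ℕ → Vertex n → Bool
sphereᵇ x r z = dist x z ≡ᵇ r

count-sphere : (x : Vertex n) (r : ℕ) → count (sphereᵇ x r) (vertices n) ≤ n C r

count-sphere-pascal : (x : Vertex n) (r : ℕ) →
  count (sphereᵇ x r) (vertices n) + count (λ z → suc (dist x z) ≡ᵇ r) (vertices n) ≤ suc n C r
count-sphere-pascal {n} x zero
  rewrite count-none {p = λ z → suc (dist x z) ≡ᵇ 0} (λ _ ()) (vertices n)
        | +-identityʳ (count (sphereᵇ x 0) (vertices n))
  = count-sphere x zero
count-sphere-pascal {n} x (suc r) = begin
  count (sphereᵇ x (suc r)) (vertices n) + count (sphereᵇ x r) (vertices n)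
    ≤⟨ +-mono-≤ (count-sphere x (suc r)) (count-sphere x r) ⟩
  n C suc r + n C r  ≡⟨ +-comm (n C suc r) _ ⟩
  n C r + n C suc r  ≡⟨ nCk+nC[k+1]≡[n+1]C[k+1] n r ⟩
  suc n C suc r      ∎
  where open ≤-Reasoning

count-sphere []          zero    = ≤-refl
count-sphere []          (suc r) = z≤n
count-sphere {suc n} (true  ∷ x) r =
  ≤-trans (≤-reflexive (count-vertices-suc {n} true _)) (count-sphere-pascal x r)
count-sphere {suc n} (false ∷ x) r =
  ≤-trans (≤-reflexive (count-vertices-suc {n} false _)) (count-sphere-pascal x r)

-- The strict triangle inequality through x says that y and z flip a common coordinate of x.
Conflict : Vertex n → Vertex n → ℕ → Vertex n → Bool
Conflict x y r z = sphereᵇ x r z ∧ (dist y z <ᵇ dist x y + dist x z)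

conflicts : Vertex n → Vertex n → ℕ → ℕ
conflicts {n} x y r = count (Conflict x y r) (vertices n)

conflicts-centre : (x y : Vertex n) → conflicts x y 0 ≡ 0
conflicts-centre x y = count-none no-conflict (vertices _)
  where
  no-conflict : ∀ z → ¬ T (Conflict x y 0 z)
  no-conflict z c with Equivalence.to T-∧ c
  ... | xz≡0 , shortcut with dist≡0⇒≡ x z (≡ᵇ⇒≡ _ 0 xz≡0)
  ... | refl = <-irrefl yx≡xy+xx (<ᵇ⇒< _ _ shortcut)
    where
    yx≡xy+xx : dist y x ≡ dist x y + dist x x
    yx≡xy+xx = trans (dist-sym y x) (sym (trans (cong (dist x y +_) (dist-self x)) (+-identityʳ _)))

conflicts-≤ : (x y : Vertex n) (j : ℕ) → conflicts x y (suc j) ≤ dist x y * (n C j)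

-- Split z by its first bit. If it agrees with x's, z is a conflict iff its tail is a conflict
-- of radius j + 1 of the tails. Otherwise its tail is a conflict of radius j when y agrees with
-- x in the first bit, and an arbitrary point of the tail sphere of radius j when it does not.
-- The second summands below are that second half, in the form it reduces to for either value
-- of the first bit.
conflicts-equal-heads : (x y : Vertex n) (j : ℕ) →
  conflicts x y (suc j)
    + count (λ z → sphereᵇ x j z ∧ (suc (dist y z) <ᵇ dist x y + suc (dist x z))) (vertices n)
  ≤ dist x y * (suc n C j)
conflicts-equal-heads {n} x y j =
  ≤-trans (+-monoʳ-≤ (conflicts x y (suc j)) (count-mono shift (vertices n))) (pascal j)
  where
  shift : ∀ z → T (sphereᵇ x j z ∧ (suc (dist y z) <ᵇ dist x y + suc (dist x z))) →
                T (Conflict x y j z)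
  shift z =
    subst T (cong (λ s → sphereᵇ x j z ∧ (suc (dist y z) <ᵇ s)) (+-suc (dist x y) (dist x z)))

  pascal : ∀ i → conflicts x y (suc i) + conflicts x y i ≤ dist x y * (suc n C i)
  pascal zero rewrite conflicts-centre x y | +-identityʳ (conflicts x y 1) = conflicts-≤ x y zero
  pascal (suc i) = begin
    conflicts x y (suc (suc i)) + conflicts x y (suc i)
      ≤⟨ +-mono-≤ (conflicts-≤ x y (suc i)) (conflicts-≤ x y i) ⟩
    dist x y * (n C suc i) + dist x y * (n C i)  ≡⟨ +-comm (dist x y * (n C suc i)) _ ⟩
    dist x y * (n C i) + dist x y * (n C suc i)  ≡⟨ *-distribˡ-+ (dist x y) (n C i) _ ⟨
    dist x y * (n C i + n C suc i)               ≡⟨ cong (dist x y *_) (nCk+nC[k+1]≡[n+1]C[k+1] n i) ⟩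
    dist x y * (suc n C suc i)                   ∎
    where open ≤-Reasoning

conflicts-distinct-heads : (x y : Vertex n) (j : ℕ) →
  conflicts x y (suc j)
    + count (λ z → sphereᵇ x j z ∧ (dist y z <ᵇ suc (dist x y) + suc (dist x z))) (vertices n)
  ≤ suc (dist x y) * (suc n C j)
conflicts-distinct-heads {n} x y j = begin
  conflicts x y (suc j) + count flipped (vertices n)
                                ≤⟨ +-mono-≤ (conflicts-≤ x y j) flipped-≤ ⟩
  dist x y * (n C j) + n C j    ≡⟨ +-comm (dist x y * (n C j)) _ ⟩
  suc (dist x y) * (n C j)      ≤⟨ *-monoʳ-≤ (suc (dist x y)) (nCk≤[1+n]Ck n j) ⟩
  suc (dist x y) * (suc n C j)  ∎
  where
  open ≤-Reasoning
  flipped : Vertex n → Bool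
  flipped z = sphereᵇ x j z ∧ (dist y z <ᵇ suc (dist x y) + suc (dist x z))

  flipped-≤ : count flipped (vertices n) ≤ n C j
  flipped-≤ =
    ≤-trans (count-mono (λ _ → proj₁ ∘ Equivalence.to T-∧) (vertices n)) (count-sphere x j)

conflicts-≤ []          []          j = z≤n
conflicts-≤ {suc n} (true  ∷ x) (true  ∷ y) j =
  ≤-trans (≤-reflexive (count-vertices-suc {n} true _)) (conflicts-equal-heads x y j)
conflicts-≤ {suc n} (false ∷ x) (false ∷ y) j =
  ≤-trans (≤-reflexive (count-vertices-suc {n} false _)) (conflicts-equal-heads x y j)
conflicts-≤ {suc n} (true  ∷ x) (false ∷ y) j =
  ≤-trans (≤-reflexive (count-vertices-suc {n} true _)) (conflicts-distinct-heads x y j)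
conflicts-≤ {suc n} (false ∷ x) (true  ∷ y) j =
  ≤-trans (≤-reflexive (count-vertices-suc {n} false _)) (conflicts-distinct-heads x y j)

sphere : Vertex n → ℕ → List (Vertex n)
sphere {n} x r = filter (λ z → dist x z ≟ r) (vertices n)

∈-sphere : (x : Vertex n) {y : Vertex n} {r : ℕ} → InSphere x r y → y ∈ sphere x r
∈-sphere x {y} {r} = ∈-filter⁺ (λ z → dist x z ≟ r) (∈-vertices y)

∈-sphere⁻ : (x : Vertex n) {y : Vertex n} {r : ℕ} → y ∈ sphere x r → InSphere x r y
∈-sphere⁻ {n} x {r = r} = proj₂ ∘ ∈-filter⁻ (λ z → dist x z ≟ r) {xs = vertices n}

closerThanᵇ : ℕ → Vertex n → Vertex n → Bool
closerThanᵇ d y z = dist y z <ᵇ d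

closerThanᵇ-refl : ∀ d (y : Vertex n) → T (closerThanᵇ (suc d) y y)
closerThanᵇ-refl d y rewrite dist-self y = _

closerThanᵇ-sym : ∀ d (y z : Vertex n) → T (closerThanᵇ d y z) → T (closerThanᵇ d z y)
closerThanᵇ-sym d y z = subst (λ e → T (e <ᵇ d)) (dist-sym y z)

sphere-degree : (x y : Vertex n) (j : ℕ) → dist x y ≡ suc j →
  count (closerThanᵇ (2 * suc j) y) (sphere x (suc j)) ≤ suc j * (n C j)
sphere-degree {n} x y j xy≡k = begin
  count (closerThanᵇ (2 * k) y) (sphere x k)
                      ≤⟨ count-filter-≤ (λ z → dist x z ≟ k) conflict (vertices n) ⟩
  conflicts x y k     ≤⟨ conflicts-≤ x y j ⟩
  dist x y * (n C j)  ≡⟨ cong (_* (n C j)) xy≡k ⟩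
  k * (n C j)         ∎
  where
  open ≤-Reasoning
  k : ℕ
  k = suc j

  2k≡xy+xz : ∀ {z} → dist x z ≡ k → 2 * k ≡ dist x y + dist x z
  2k≡xy+xz xz≡k = trans (cong (k +_) (+-identityʳ k)) (sym (cong₂ _+_ xy≡k xz≡k))

  conflict : ∀ {z} → dist x z ≡ k → T (closerThanᵇ (2 * k) y z) → T (Conflict x y k z)
  conflict {z} xz≡k yz<2k = Equivalence.from T-∧
    (≡⇒≡ᵇ _ _ xz≡k , subst (λ s → T (dist y z <ᵇ s)) (2k≡xy+xz xz≡k) yz<2k)

lemma9 : (n k : ℕ) → 1 ≤ k → (x : Vertex n) →
    Σ ℕ (λ m →
      Σ ((y : Vertex n) → InSphere x k y → Fin m) (λ c →
        (m ≤ k * (n C (k ∸ 1)))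
        × (k * (n C (k ∸ 1)) ≤ 2 * n ^ (k ∸ 1))
        × ((y z : Vertex n) (hy : InSphere x k y) (hz : InSphere x k z) →
            c y hy ≡ c z hz → ¬ (y ≡ z) → 2 * k ≤ dist y z)))
lemma9 n (suc j) _ x =
  suc j * (n C j) , (λ _ y∈S → colour (∈-sphere x y∈S)) ,
  ≤-refl , [1+k]*nCk≤2*n^k n j , separated
  where
  open GreedyColouring (closerThanᵇ (2 * suc j)) (closerThanᵇ-refl _) (closerThanᵇ-sym (2 * suc j))

  colouring : Σ (Colouring (suc j * (n C j)) (sphere x (suc j))) (Proper (sphere x (suc j)))
  colouring = greedy _ (sphere x (suc j)) (λ y∈S → sphere-degree x _ j (∈-sphere⁻ x y∈S))

  colour : Colouring (suc j * (n C j)) (sphere x (suc j))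
  colour = proj₁ colouring

  separated : (y z : Vertex n) (hy : InSphere x (suc j) y) (hz : InSphere x (suc j) z) →
              colour (∈-sphere x hy) ≡ colour (∈-sphere x hz) → y ≢ z → 2 * suc j ≤ dist y z
  separated y z hy hz same y≢z =
    ≮⇒≥ λ close → proj₂ colouring (∈-sphere x hy) (∈-sphere x hz) (<⇒<ᵇ close) y≢z same
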